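{- Let $G=(V,E)$ be a $d$-regular graph on $n=|V|$ vertices, identified with $[n]$, which is a vertex expander with vertex isoperimetric constant $h(G)=\gamma>0$. Let $\mathcal{A}_G=\{\partial(\{v\}): v\in V\}\subseteq\binom{[n]}{d}$. Then $\mathcal{A}_G$ has distance amplification: for all $x,y\in\{0,1\}^n$ with $\delta:=\Delta(x,y)<1/d$, one has $\Delta(\mathrm{DP}_{\mathcal{A}_G}(x),\mathrm{DP}_{\mathcal{A}_G}(y))=\Omega(d\delta)$ (with the implied constant depending only on $\gamma$).
   Context: For $S\subseteq V$, $\partial(S)=\{u\in V\setminus S:\exists v\in S,\ (u,v)\in E\}$. The vertex isoperimetric constant is $h(G)=\min_{0<|S|\le|V|/d}\frac{|\partial(S)|}{|S|\cdot d}$. For $x,y\in\{0,1\}^n$, $\Delta(x,y)$ is the fraction of coordinates where they differ. For a collection $\mathcal{A}$ of subsets of $[n]$ and $a\in\{0,1\}^n$, $\mathrm{DP}_{\mathcal{A}}(a)$ assigns to each $S\in\mathcal{A}$ the restriction $a|_S$, and $\Delta(\mathrm{DP}_{\mathcal{A}}(x),\mathrm{DP}_{\mathcal{A}}(y))$ is the fraction of $S\in\mathcal{A}$ with $x|_S\neq y|_S$. A domain $\mathcal{A}\subseteq\binom{[n]}{k}$ has distance amplification if for all $x,y$ with $\delta=\Delta(x,y)<1/k$, $\Delta(\mathrm{DP}_{\mathcal{A}}(x),\mathrm{DP}_{\mathcal{A}}(y))=\Omega(k\delta)$. -}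

module Defs where

open import Data.Nat using (ℕ; zero; suc; _*_) renaming (_≤_ to _≤ℕ_)
open import Data.Bool using (Bool; true; false; _∧_; _∨_; not; _xor_)
open import Data.Fin using (Fin) renaming (zero to fzero; suc to fsuc)
open import Data.Fin.Subset using (Subset; ∣_∣; ⁅_⁆)
open import Data.Vec using (Vec; lookup; tabulate)
open import Data.Integer using (+_)
open import Data.Rational using (ℚ; _/_; 0ℚ; _≤_)
open import Data.Product using (Σ; _×_)
open import Relation.Binary.PropositionalEquality using (_≡_)

-- fraction k / m as a rational; convention: k / 0 = 0 (never used with m = 0
-- in the statement's meaningful cases).
frac : ℕ → ℕ → ℚ
frac k zero    = 0ℚ
frac k (suc m) = (+ k) / suc m

anyFin : ∀ {n} → (Fin n → Bool) → Bool
anyFin {zero}  p = false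
anyFin {suc n} p = p fzero ∨ anyFin (λ i → p (fsuc i))

record Graph (n : ℕ) : Set where
  field
    adj    : Fin n → Fin n → Bool
    sym    : ∀ u v → adj u v ≡ adj v u
    irrefl : ∀ v → adj v v ≡ false
open Graph public

∂ : ∀ {n} → Graph n → Subset n → Subset n
∂ G S = tabulate λ u → not (lookup S u) ∧ anyFin (λ v → lookup S v ∧ adj G u v)

Regular : ∀ {n} → Graph n → ℕ → Set
Regular G d = ∀ v → ∣ ∂ G ⁅ v ⁆ ∣ ≡ d

-- Admissible S for h(G):  0 < |S| ≤ |V|/d  (written |S|·d ≤ |V|, for d ≥ 1)
Admissible : ∀ {n} → ℕ → Subset n → Set
Admissible {n} d S = 1 ≤ℕ ∣ S ∣ × ∣ S ∣ * d ≤ℕ n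

isoRatio : ∀ {n} → Graph n → ℕ → Subset n → ℚ
isoRatio G d S = frac ∣ ∂ G S ∣ (∣ S ∣ * d)

HasVertexIsoConst : ∀ {n} → Graph n → ℕ → ℚ → Set
HasVertexIsoConst {n} G d γ =
  (∀ (S : Subset n) → Admissible d S → γ ≤ isoRatio G d S) ×
  Σ (Subset n) (λ S → Admissible d S × isoRatio G d S ≡ γ)

Δ : ∀ {n} → Vec Bool n → Vec Bool n → ℚ
Δ {n} x y = frac ∣ tabulate (λ i → lookup x i xor lookup y i) ∣ n

restrictionsDiffer : ∀ {n} → Subset n → Vec Bool n → Vec Bool n → Bool
restrictionsDiffer S x y = anyFin (λ u → lookup S u ∧ (lookup x u xor lookup y u))

-- Δ(DP_{A_G}(x), DP_{A_G}(y)), where A_G = { ∂({v}) : v ∈ V } indexed by v ∈ V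
ΔDP : ∀ {n} → Graph n → Vec Bool n → Vec Bool n → ℚ
ΔDP {n} G x y = frac ∣ tabulate (λ v → restrictionsDiffer (∂ G ⁅ v ⁆) x y) ∣ n

-- Let D be the set of coordinates where x and y differ, so |D| = δn. As δ < 1/d, a nonempty D
-- is admissible for h(G), whence |∂D| ≥ γ·d·|D|. A vertex v ∈ ∂D has a neighbour u ∈ D, and
-- u ∈ ∂({v}), so x and y already differ on the block ∂({v}). Thus at least |∂D| ≥ γ·d·δ·n of
-- the n blocks differ, and c = γ works.
module Submission where

open import Defs hiding (sym)
open import Data.Nat as ℕ using (ℕ; zero; suc; s≤s; z≤n) renaming (_≤_ to _≤ℕ_; _<_ to _<ℕ_)
import Data.Nat.Properties as ℕ
open import Data.Bool using (Bool; true; false; _∧_; _∨_; not; _xor_)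
open import Data.Bool.Properties using (∨-zeroʳ; ∧-conicalˡ; ∧-conicalʳ; not-injective)
open import Data.Fin using (Fin) renaming (zero to fzero; suc to fsuc)
open import Data.Fin.Subset using (Subset; ∣_∣; ⁅_⁆; _∈_; _∉_; _⊆_)
open import Data.Fin.Subset.Properties using (x∈⁅x⁆; x∈⁅y⁆⇒x≡y; ∣p∣≤n; p⊆q⇒∣p∣≤∣q∣)
open import Data.Vec using (Vec; lookup; tabulate)
open import Data.Vec.Properties using (lookup∘tabulate; []=⇒lookup; lookup⇒[]=)
open import Data.Integer as ℤ using (+_; +≤+)
import Data.Integer.Properties as ℤ
open import Data.Rational using (ℚ; 0ℚ; _<_; _≤_; _*_; _/_; toℚᵘ; NonNegative; nonNegative)
open import Data.Rational.Properties
open import Data.Rational.Unnormalised as ᵘ using (mkℚᵘ; *≡*; *≤*; *<*) renaming (_≃_ to _≃ᵘ_)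
import Data.Rational.Unnormalised.Properties as ᵘ
open import Data.Product using (Σ; _×_; _,_; proj₁; proj₂; ∃-syntax)
open import Function using (_∘_)
open import Relation.Nullary using (contradiction)
open import Relation.Binary.PropositionalEquality

toℚᵘ-frac : ∀ k n → toℚᵘ (frac k (suc n)) ≃ᵘ mkℚᵘ (+ k) n
toℚᵘ-frac k n = toℚᵘ-fromℚᵘ (mkℚᵘ (+ k) n)

frac-zero : ∀ n → frac 0 n ≡ 0ℚ
frac-zero zero    = refl
frac-zero (suc n) = 0/n≡0 (suc n)

frac-nonNeg : ∀ k n → 0ℚ ≤ frac k n
frac-nonNeg k zero    = ≤-refl
frac-nonNeg k (suc n) = nonNegative⁻¹ (frac k (suc n)) {{normalize-nonNeg k (suc n)}}

frac-monoˡ-≤ : ∀ {k l} n → k ≤ℕ l → frac k n ≤ frac l n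
frac-monoˡ-≤ zero    k≤l = ≤-refl
frac-monoˡ-≤ {k} {l} (suc n) k≤l = toℚᵘ-cancel-≤
  (ᵘ.≤-respˡ-≃ (ᵘ.≃-sym (toℚᵘ-frac k n)) (ᵘ.≤-respʳ-≃ (ᵘ.≃-sym (toℚᵘ-frac l n))
    (*≤* (ℤ.*-monoʳ-≤-nonNeg (+ suc n) (+≤+ k≤l)))))

frac<frac⇒*< : ∀ a b c e → frac a (suc b) < frac c (suc e) → a ℕ.* suc e <ℕ c ℕ.* suc b
frac<frac⇒*< a b c e lt with ᵘ.<-respˡ-≃ (toℚᵘ-frac a b) (ᵘ.<-respʳ-≃ (toℚᵘ-frac c e) (toℚᵘ-mono-< lt))
... | *<* p rewrite sym (ℤ.pos-* a (suc e)) | sym (ℤ.pos-* c (suc b)) = ℤ.drop‿+<+ p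

frac-*-cancel : ∀ k q n → frac k (suc q) * frac (suc q) n ≡ frac k n
frac-*-cancel k q zero    = *-zeroʳ (frac k (suc q))
frac-*-cancel k q (suc n) = toℚᵘ-injective (begin
  toℚᵘ (frac k (suc q) * frac (suc q) (suc n))        ≈⟨ toℚᵘ-homo-* (frac k (suc q)) _ ⟩
  toℚᵘ (frac k (suc q)) ᵘ.* toℚᵘ (frac (suc q) (suc n)) ≈⟨ ᵘ.*-cong (toℚᵘ-frac k q) (toℚᵘ-frac (suc q) n) ⟩
  mkℚᵘ (+ k) q ᵘ.* mkℚᵘ (+ suc q) n                    ≈⟨ *≡* cancel ⟩
  mkℚᵘ (+ k) n                                         ≈⟨ toℚᵘ-frac k n ⟨
  toℚᵘ (frac k (suc n))                                ∎)
  where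
  open ᵘ.≃-Reasoning
  cancel : (+ k ℤ.* + suc q) ℤ.* + suc n ≡ + k ℤ.* + (suc q ℕ.* suc n)
  cancel = trans (ℤ.*-assoc (+ k) (+ suc q) (+ suc n)) (cong (+ k ℤ.*_) (sym (ℤ.pos-* (suc q) (suc n))))

ℕ/1-*-frac : ∀ d m n → (+ d / 1) * frac m n ≡ frac (m ℕ.* d) n
ℕ/1-*-frac d m zero    = *-zeroʳ (+ d / 1)
ℕ/1-*-frac d m (suc n) = toℚᵘ-injective (begin
  toℚᵘ ((+ d / 1) * frac m (suc n))              ≈⟨ toℚᵘ-homo-* (+ d / 1) _ ⟩
  toℚᵘ (+ d / 1) ᵘ.* toℚᵘ (frac m (suc n))        ≈⟨ ᵘ.*-cong (toℚᵘ-frac d 0) (toℚᵘ-frac m n) ⟩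
  mkℚᵘ (+ d) 0 ᵘ.* mkℚᵘ (+ m) n                  ≈⟨ *≡* commute ⟩
  mkℚᵘ (+ (m ℕ.* d)) n                          ≈⟨ toℚᵘ-frac (m ℕ.* d) n ⟨
  toℚᵘ (frac (m ℕ.* d) (suc n))                  ∎)
  where
  open ᵘ.≃-Reasoning
  commute : (+ d ℤ.* + m) ℤ.* + suc n ≡ + (m ℕ.* d) ℤ.* + (1 ℕ.* suc n)
  commute rewrite ℕ.*-identityˡ (suc n) =
    cong (ℤ._* + suc n) (trans (ℤ.*-comm (+ d) (+ m)) (sym (ℤ.pos-* m d)))

≤frac⇒*frac≤frac : ∀ (γ : ℚ) q k n → (1 ≤ℕ q → γ ≤ frac k q) → γ * frac q n ≤ frac k n
≤frac⇒*frac≤frac γ zero k n _ = begin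
  γ * frac 0 n  ≡⟨ cong (γ *_) (frac-zero n) ⟩
  γ * 0ℚ        ≡⟨ *-zeroʳ γ ⟩
  0ℚ            ≤⟨ frac-nonNeg k n ⟩
  frac k n      ∎
  where open ≤-Reasoning
≤frac⇒*frac≤frac γ (suc q) k n γ≤k/q = begin
  γ * frac (suc q) n                ≤⟨ *-monoʳ-≤-nonNeg (frac (suc q) n) {{q/n≥0}} (γ≤k/q (s≤s z≤n)) ⟩
  frac k (suc q) * frac (suc q) n   ≡⟨ frac-*-cancel k q n ⟩
  frac k n                          ∎
  where
  open ≤-Reasoning
  q/n≥0 : NonNegative (frac (suc q) n)
  q/n≥0 = nonNegative (frac-nonNeg (suc q) n)

frac<1/d⇒*≤ : ∀ {m n} d → m ≤ℕ n → frac m n < frac 1 (suc d) → m ℕ.* suc d ≤ℕ n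
frac<1/d⇒*≤ {n = zero}      d z≤n _ = z≤n
frac<1/d⇒*≤ {m} {n = suc n} d _ m/n<1/d =
  ℕ.<⇒≤ (subst (m ℕ.* suc d <ℕ_) (ℕ.*-identityˡ (suc n)) (frac<frac⇒*< m n 1 d m/n<1/d))

anyFin⁺ : ∀ {n} (p : Fin n → Bool) i → p i ≡ true → anyFin p ≡ true
anyFin⁺ p fzero    pi≡true rewrite pi≡true = refl
anyFin⁺ p (fsuc i) pi≡true = trans (cong (p fzero ∨_) (anyFin⁺ (p ∘ fsuc) i pi≡true)) (∨-zeroʳ (p fzero))

anyFin⁻ : ∀ {n} (p : Fin n → Bool) → anyFin p ≡ true → ∃[ i ] p i ≡ true
anyFin⁻ {zero}  p ()
anyFin⁻ {suc n} p any≡true with p fzero in p0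
... | true  = fzero , p0
... | false = let i , pi≡true = anyFin⁻ (p ∘ fsuc) any≡true in fsuc i , pi≡true

∈-tabulate⁺ : ∀ {n} {f : Fin n → Bool} {i} → f i ≡ true → i ∈ tabulate f
∈-tabulate⁺ {f = f} {i} fi≡true = lookup⇒[]= i (tabulate f) (trans (lookup∘tabulate f i) fi≡true)

∈-tabulate⁻ : ∀ {n} {f : Fin n → Bool} {i} → i ∈ tabulate f → f i ≡ true
∈-tabulate⁻ {f = f} {i} i∈ = trans (sym (lookup∘tabulate f i)) ([]=⇒lookup i∈)

∉⇒lookup≡false : ∀ {n} {x : Fin n} (p : Subset n) → x ∉ p → lookup p x ≡ false
∉⇒lookup≡false {x = x} p x∉p with lookup p x in px
... | false = refl
... | true  = contradiction (lookup⇒[]= x p px) x∉p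

lookup≡false⇒∉ : ∀ {n} {x : Fin n} {p : Subset n} → lookup p x ≡ false → x ∉ p
lookup≡false⇒∉ px≡false x∈p with trans (sym ([]=⇒lookup x∈p)) px≡false
... | ()

module _ {n} (G : Graph n) where

  ∈∂⁺ : ∀ {S u v} → u ∉ S → v ∈ S → adj G u v ≡ true → u ∈ ∂ G S
  ∈∂⁺ {S} {u} {v} u∉S v∈S uv∈E = ∈-tabulate⁺ (cong₂ _∧_
    (cong not (∉⇒lookup≡false S u∉S))
    (anyFin⁺ _ v (cong₂ _∧_ ([]=⇒lookup v∈S) uv∈E)))

  ∈∂⁻ : ∀ {S u} → u ∈ ∂ G S → u ∉ S × ∃[ v ] v ∈ S × adj G u v ≡ true
  ∈∂⁻ {S} {u} u∈∂S with ∈-tabulate⁻ u∈∂S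
  ... | u∉S∧meets with anyFin⁻ _ (∧-conicalʳ _ _ u∉S∧meets)
  ... | v , v∈S∧uv∈E =
    lookup≡false⇒∉ (not-injective (∧-conicalˡ _ _ u∉S∧meets)) , v ,
    lookup⇒[]= v S (∧-conicalˡ _ _ v∈S∧uv∈E) , ∧-conicalʳ _ _ v∈S∧uv∈E

  ∈∂⇒∂⁅⁆-meets : ∀ {S v} → v ∈ ∂ G S → ∃[ u ] u ∈ S × u ∈ ∂ G ⁅ v ⁆
  ∈∂⇒∂⁅⁆-meets {S} {v} v∈∂S with ∈∂⁻ v∈∂S
  ... | v∉S , u , u∈S , vu∈E = u , u∈S , ∈∂⁺ u∉⁅v⁆ (x∈⁅x⁆ v) (trans (Graph.sym G u v) vu∈E)
    where
    u∉⁅v⁆ : u ∉ ⁅ v ⁆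
    u∉⁅v⁆ u∈⁅v⁆ = v∉S (subst (_∈ S) (x∈⁅y⁆⇒x≡y v u∈⁅v⁆) u∈S)

differingCoords : ∀ {n} → Vec Bool n → Vec Bool n → Subset n
differingCoords x y = tabulate (λ i → lookup x i xor lookup y i)

distinguishingVertices : ∀ {n} → Graph n → Vec Bool n → Vec Bool n → Subset n
distinguishingVertices G x y = tabulate (λ v → restrictionsDiffer (∂ G ⁅ v ⁆) x y)

restrictionsDiffer⁺ : ∀ {n} {S : Subset n} {x y u} →
  u ∈ S → u ∈ differingCoords x y → restrictionsDiffer S x y ≡ true
restrictionsDiffer⁺ {u = u} u∈S u∈D = anyFin⁺ _ u (cong₂ _∧_ ([]=⇒lookup u∈S) (∈-tabulate⁻ u∈D))

∂-differingCoords⊆distinguishingVertices : ∀ {n} (G : Graph n) x y →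
  ∂ G (differingCoords x y) ⊆ distinguishingVertices G x y
∂-differingCoords⊆distinguishingVertices G x y v∈∂D =
  let u , u∈D , u∈∂v = ∈∂⇒∂⁅⁆-meets G v∈∂D in ∈-tabulate⁺ (restrictionsDiffer⁺ {x = x} {y} u∈∂v u∈D)

claimE3 : (γ : ℚ) → 0ℚ < γ →
    Σ ℚ (λ c → 0ℚ < c ×
      (∀ (n d : ℕ) (G : Graph n) → 1 ≤ℕ d → Regular G d →
        HasVertexIsoConst G d γ →
        ∀ (x y : Vec Bool n) → Δ x y < frac 1 d →
        c * ((+ d / 1) * Δ x y) ≤ ΔDP G x y))
claimE3 γ 0<γ = γ , 0<γ , amplification
  where
  amplification : ∀ (n d : ℕ) (G : Graph n) → 1 ≤ℕ d → Regular G d →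
    HasVertexIsoConst G d γ →
    ∀ (x y : Vec Bool n) → Δ x y < frac 1 d →
    γ * ((+ d / 1) * Δ x y) ≤ ΔDP G x y
  amplification n zero G ()
  amplification n (suc d) G _ _ (γ≤isoRatio , _) x y δ<1/d = begin
    γ * ((+ suc d / 1) * Δ x y)  ≡⟨ cong (γ *_) (ℕ/1-*-frac (suc d) ∣ D ∣ n) ⟩
    γ * frac (∣ D ∣ ℕ.* suc d) n  ≤⟨ ≤frac⇒*frac≤frac γ _ _ n (γ≤isoRatio D ∘ admissible) ⟩
    frac ∣ ∂ G D ∣ n              ≤⟨ frac-monoˡ-≤ n (p⊆q⇒∣p∣≤∣q∣ (∂-differingCoords⊆distinguishingVertices G x y)) ⟩
    ΔDP G x y                    ∎
    where
    open ≤-Reasoning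
    D = differingCoords x y
    admissible : 1 ≤ℕ ∣ D ∣ ℕ.* suc d → Admissible (suc d) D
    admissible md≥1 =
      ℕ.>-nonZero⁻¹ ∣ D ∣ {{ℕ.m*n≢0⇒m≢0 ∣ D ∣ {{ℕ.>-nonZero md≥1}}}} , frac<1/d⇒*≤ d (∣p∣≤n D) δ<1/d
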